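{- Let $d\ge 1$ and $n\ge d$ be integers. If $S\subseteq\mathbb{Z}_{2^n}$ is a union of layers and $|S|>|\mathcal{C}_d|$, then $S$ contains a projective $d$-cube, i.e.\ there is a multiset $T$ of $d$ elements of $\mathbb{Z}_{2^n}$ with $\Sigma^*T\subseteq S$.
   Context: $\mathbb{Z}_{2^n}$ is the cyclic group of integers modulo $2^n$. For $1\le i\le n$ the $i$-th layer is $L_i=\{x\in\mathbb{Z}_{2^n}: x\equiv 2^{i-1} \pmod{2^i}\}$, and $L_{n+1}=\{0\}$; a union of layers is a set of the form $\bigcup_{i\in J}L_i$ for some $J\subseteq\{1,\dots,n+1\}$. For a multiset $T=\{a_1,\dots,a_d\}$ of $d$ not necessarily distinct elements, $\Sigma^*T=\{\sum_{i\in I}a_i \bmod 2^n : \emptyset\neq I\subseteq\{1,\dots,d\}\}$ (a set). Define index sets recursively: $I_1=\emptyset$; for $d\ge 2$, let $\ell$ be the largest integer with $2^\ell\le d$ and set $I_d=\{1,\dots,\ell\}\cup\{j+\ell+1: j\in I_{d-2^\ell+1}\}$. Then $\mathcal{C}_d=\bigcup_{i\in I_d}L_i$. -}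

module Defs where

open import Data.Nat using (ℕ; zero; suc; _+_; _∸_; _^_; _≤_; _<_; _%_; NonZero)
open import Data.Nat.Properties using (_≟_; _≤?_; m^n≢0)
open import Data.Nat.DivMod using (_mod_)
open import Data.Nat.Logarithm using (⌊log₂_⌋)
open import Data.Bool using (Bool; true; false; if_then_else_)
open import Data.Fin using (Fin; toℕ)
open import Data.Fin.Subset using (Subset)
open import Data.Vec using (Vec; []; _∷_; tabulate)
open import Data.List using (List; []; _++_; map; upTo)
open import Data.Bool.ListAction using (any)
open import Data.Product using (_×_)
open import Data.Sum using (_⊎_)
open import Relation.Binary.PropositionalEquality using (_≡_)
open import Relation.Nullary using (Dec)
open import Relation.Nullary.Decidable using (isYes; _×-dec_; _⊎-dec_)

-- Elements of ℤ_{2^n} are represented by Fin (2 ^ n); subsets by Subset (2 ^ n).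

_%2^_ : ℕ → ℕ → ℕ
x %2^ i = _%_ x (2 ^ i) {{m^n≢0 2 i}}

_mod2^_ : ℕ → (n : ℕ) → Fin (2 ^ n)
x mod2^ n = _mod_ x (2 ^ n) {{m^n≢0 2 n}}

-- x ∈ L_i  (layer i of ℤ_{2^n}), for x represented as a natural number < 2^n.
-- For 1 ≤ i ≤ n:  x ≡ 2^{i-1} (mod 2^i);  L_{n+1} = {0}.
Layer : ℕ → ℕ → ℕ → Set
Layer n i x = (1 ≤ i × i ≤ n × x %2^ i ≡ 2 ^ (i ∸ 1)) ⊎ (i ≡ suc n × x ≡ 0)

layer? : ∀ n i x → Dec (Layer n i x)
layer? n i x = ((1 ≤? i) ×-dec ((i ≤? n) ×-dec (x %2^ i ≟ 2 ^ (i ∸ 1))))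
               ⊎-dec ((i ≟ suc n) ×-dec (x ≟ 0))

unionLayers : (n : ℕ) → List ℕ → Subset (2 ^ n)
unionLayers n J = tabulate (λ x → any (λ i → isYes (layer? n i (toℕ x))) J)

-- Index sets I_d (fuel-bounded recursion; fuel d suffices since
-- d - 2^ℓ + 1 < d for d ≥ 2).
indexAux : ℕ → ℕ → List ℕ
indexAux zero d = []
indexAux (suc f) zero = []
indexAux (suc f) (suc zero) = []
indexAux (suc f) (suc (suc k)) =
  let d = suc (suc k)
      ℓ = ⌊log₂ d ⌋
  in map suc (upTo ℓ) ++ map (λ j → j + ℓ + 1) (indexAux f (d ∸ 2 ^ ℓ + 1))

I : ℕ → List ℕ
I d = indexAux d d

C : (n d : ℕ) → Subset (2 ^ n)
C n d = unionLayers n (I d)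

subsetSum : ∀ {m d} → Vec (Fin m) d → Subset d → ℕ
subsetSum [] [] = 0
subsetSum (a ∷ T) (true ∷ P) = toℕ a + subsetSum T P
subsetSum (a ∷ T) (false ∷ P) = subsetSum T P

module Submission where

-- Layers are handled through the layer index layerOf n x = 1 + v₂(x) (with
-- 0 in layer n + 1), which is first shown to agree with the congruence
-- definition of Defs.  A union of layers is then described by a Boolean
-- layer predicate P, whose size is the closed count
-- countLayers n P = Σ_{i ≤ n, P i} 2^{n-i} + [P (n + 1)].
-- Working with natural numbers, we build a layer cube: d numbers all of whose
-- nonempty subset sums have their layer index in P.  The construction follows
-- the recursion defining I_d; for d ≥ 2 and ℓ = ⌊log₂ d⌋: if P misses a layer
-- ≤ ℓ its count is at most that of I_d; if P contains the layers 1, …, ℓ + 1,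
-- d copies of 1 work; otherwise the layers of P above ℓ + 1 beat
-- I_{d - 2^ℓ + 1} in ℤ_{2^{n-ℓ-1}}, and 2^ℓ - 1 ones together with 2^{ℓ+1}
-- times the cube obtained recursively work.  Reducing a layer cube modulo
-- 2^n finally gives the required projective cube.

open import Defs
open import Data.Nat using (ℕ; zero; suc; _+_; _*_; _∸_; _^_; _≤_; _<_; z≤n; s≤s; _%_; _/_; _≡ᵇ_; ⌊_/2⌋; parity; NonZero)
open import Data.Nat.Properties
open import Data.Nat.DivMod
  using (%-congˡ; m≡m%n+[m/n]*n; [m+kn]%n≡m%n; m<n⇒m%n≡m; m%n<n; n%1≡0; %-distribˡ-+; m%n%n≡m%n)
open import Data.Nat.Logarithm using (⌊log₂_⌋)
open import Data.Nat.Logarithm.Core using (⌊log2⌋)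
open import Data.Nat.Induction using (<-wellFounded)
open import Data.Nat.Tactic.RingSolver using (solve-∀)
open import Induction.WellFounded using (Acc; acc)
open import Data.Parity.Base using (Parity; 0ℙ; 1ℙ)
open import Data.Bool using (Bool; true; false; _∨_)
open import Data.Bool.Properties using (T-≡; ⇔→≡; ¬-not)
open import Data.Bool.ListAction using (any)
open import Data.Fin using (Fin; zero; suc; toℕ)
open import Data.Fin.Properties using (toℕ<n; toℕ-fromℕ<)
open import Data.Fin.Subset using (Subset; _∈_; ∣_∣; Nonempty; Empty; ⊥)
open import Data.Fin.Subset.Properties using (nonempty?; Empty-unique; drop-∷-Empty; drop-there)
open import Data.Vec using (Vec; []; _∷_; tabulate; splitAt; here)
  renaming (_++_ to _++ᵛ_; map to mapᵛ; replicate to replicateᵛ)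
open import Data.Vec.Properties using (lookup⇒[]=; lookup∘tabulate)
open import Data.List using (List; _∷_; []; map; upTo)
open import Data.List.Relation.Unary.All using (All)
import Data.List.Relation.Unary.Any as Any
open import Data.List.Relation.Unary.Any.Properties using (any⇔)
open import Data.List.Membership.Propositional using () renaming (_∈_ to _∈L_; _∉_ to _∉L_)
open import Data.List.Membership.Propositional.Properties
  using (∈-map⁺; ∈-map⁻; ∈-++⁺ˡ; ∈-++⁺ʳ; ∈-++⁻; ∈-upTo⁺; ∈-upTo⁻)
open import Data.Product using (Σ; _×_; _,_; proj₁; proj₂)
open import Data.Sum using (_⊎_; inj₁; inj₂)
open import Data.Empty using (⊥-elim)
open import Function.Bundles using (_⇔_; mk⇔; Equivalence)
open import Function.Properties.Equivalence using () renaming (trans to ⇔-trans; sym to ⇔-sym)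
open import Relation.Nullary using (yes; no)
open import Relation.Nullary.Decidable using (isYes; isYes≗does; does-⇔)
open import Relation.Binary.PropositionalEquality
  using (_≡_; _≢_; refl; sym; trans; cong; cong₂; subst; subst₂; module ≡-Reasoning)

data ParityView : ℕ → Set where
  even : ∀ z → ParityView (2 * z)
  odd  : ∀ z → ParityView (1 + 2 * z)

parityView : ∀ x → ParityView x
parityView zero = even 0
parityView (suc zero) = odd 0
parityView (suc (suc x)) with parityView x
... | even z = subst ParityView (*-suc 2 z) (even (suc z))
... | odd z  = subst ParityView (cong suc (*-suc 2 z)) (odd (suc z))

-- The layer index of x in ℤ_{2^n}: one plus the 2-adic valuation of x,
-- with the residue 0 placed in layer n + 1.
continueLayer : Parity → ℕ → ℕ
continueLayer 0ℙ l = suc l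
continueLayer 1ℙ l = 1

layerOf : ℕ → ℕ → ℕ
layerOf zero    x = 1
layerOf (suc n) x = continueLayer (parity x) (layerOf n ⌊ x /2⌋)

parity-even : ∀ z → parity (2 * z) ≡ 0ℙ
parity-even zero = refl
parity-even (suc z) rewrite *-suc 2 z = parity-even z

parity-odd : ∀ z → parity (1 + 2 * z) ≡ 1ℙ
parity-odd zero = refl
parity-odd (suc z) = trans (cong (λ w → parity (suc w)) (*-suc 2 z)) (parity-odd z)

half-even : ∀ z → ⌊ 2 * z /2⌋ ≡ z
half-even zero = refl
half-even (suc z) rewrite *-suc 2 z = cong suc (half-even z)

layerOf-even : ∀ n z → layerOf (suc n) (2 * z) ≡ suc (layerOf n z)
layerOf-even n z rewrite parity-even z | half-even z = refl

layerOf-odd : ∀ n z → layerOf (suc n) (1 + 2 * z) ≡ 1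
layerOf-odd n z rewrite parity-odd z = refl

layerOf-pos : ∀ n x → 1 ≤ layerOf n x
layerOf-pos zero x = s≤s z≤n
layerOf-pos (suc n) x with parity x
... | 0ℙ = s≤s z≤n
... | 1ℙ = s≤s z≤n

double-+ : ∀ z p k → 2 * z + 2 * p * k ≡ 2 * (z + p * k)
double-+ = solve-∀

-- Multiples of 2^n do not change the layer index in ℤ_{2^n}, so it is well
-- defined on residues.
layerOf-periodic : ∀ n x k → layerOf n (x + 2 ^ n * k) ≡ layerOf n x
layerOf-periodic zero x k = refl
layerOf-periodic (suc n) x k with parityView x
... | even z = begin
  layerOf (suc n) (2 * z + 2 * 2 ^ n * k) ≡⟨ cong (layerOf (suc n)) (double-+ z (2 ^ n) k) ⟩
  layerOf (suc n) (2 * (z + 2 ^ n * k))   ≡⟨ layerOf-even n _ ⟩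
  suc (layerOf n (z + 2 ^ n * k))         ≡⟨ cong suc (layerOf-periodic n z k) ⟩
  suc (layerOf n z)                       ≡⟨ layerOf-even n z ⟨
  layerOf (suc n) (2 * z)                 ∎
  where open ≡-Reasoning
... | odd z = begin
  layerOf (suc n) (1 + (2 * z + 2 * 2 ^ n * k)) ≡⟨ cong (λ w → layerOf (suc n) (1 + w)) (double-+ z (2 ^ n) k) ⟩
  layerOf (suc n) (1 + 2 * (z + 2 ^ n * k))     ≡⟨ layerOf-odd n (z + 2 ^ n * k) ⟩
  1                                             ≡⟨ layerOf-odd n z ⟨
  layerOf (suc n) (1 + 2 * z)                   ∎
  where open ≡-Reasoning

-- A number 1 ≤ k < 2^j, shifted by any multiple of 2^j, lies in one of the
-- layers 1, …, j: its lowest j binary digits are not all zero.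
layerOf-bound : ∀ n j k t → 1 ≤ k → k < 2 ^ j → layerOf n (k + 2 ^ j * t) ≤ j
layerOf-bound n zero k t 1≤k k<1 = ⊥-elim (<⇒≱ k<1 1≤k)
layerOf-bound zero (suc j) k t _ _ = s≤s z≤n
layerOf-bound (suc n) (suc j) k t 1≤k k<2^j with parityView k
... | odd z = begin
  layerOf (suc n) (1 + (2 * z + 2 * 2 ^ j * t)) ≡⟨ cong (λ w → layerOf (suc n) (1 + w)) (double-+ z (2 ^ j) t) ⟩
  layerOf (suc n) (1 + 2 * (z + 2 ^ j * t))     ≡⟨ layerOf-odd n (z + 2 ^ j * t) ⟩
  1                                             ≤⟨ s≤s z≤n ⟩
  suc j                                         ∎
  where open ≤-Reasoning
... | even z = begin
  layerOf (suc n) (2 * z + 2 * 2 ^ j * t) ≡⟨ cong (layerOf (suc n)) (double-+ z (2 ^ j) t) ⟩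
  layerOf (suc n) (2 * (z + 2 ^ j * t))   ≡⟨ layerOf-even n _ ⟩
  suc (layerOf n (z + 2 ^ j * t))         ≤⟨ s≤s (layerOf-bound n j z t (half-pos z 1≤k) (*-cancelˡ-< 2 z (2 ^ j) k<2^j)) ⟩
  suc j                                   ∎
  where
  open ≤-Reasoning
  half-pos : ∀ z → 1 ≤ 2 * z → 1 ≤ z
  half-pos (suc z) _ = s≤s z≤n

layerOf-shift : ∀ a n s → layerOf (a + n) (2 ^ a * s) ≡ a + layerOf n s
layerOf-shift zero n s = cong (layerOf n) (+-identityʳ s)
layerOf-shift (suc a) n s = begin
  layerOf (suc (a + n)) (2 * 2 ^ a * s)   ≡⟨ cong (layerOf (suc (a + n))) (*-assoc 2 (2 ^ a) s) ⟩
  layerOf (suc (a + n)) (2 * (2 ^ a * s)) ≡⟨ layerOf-even (a + n) _ ⟩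
  suc (layerOf (a + n) (2 ^ a * s))       ≡⟨ cong suc (layerOf-shift a n s) ⟩
  suc (a + layerOf n s)                   ∎
  where open ≡-Reasoning

odd≢even : ∀ a b → 1 + 2 * a ≢ 2 * b
odd≢even a b eq with trans (sym (parity-odd a)) (trans (cong parity eq) (parity-even b))
... | ()

digit+double< : ∀ {r a M} → r < 2 → a < M → r + 2 * a < 2 * M
digit+double< {r} {a} {M} r<2 a<M = begin-strict
  r + 2 * a <⟨ +-monoˡ-< (2 * a) r<2 ⟩
  2 + 2 * a ≡⟨ *-suc 2 a ⟨
  2 * suc a ≤⟨ *-monoʳ-≤ 2 a<M ⟩
  2 * M     ∎
  where open ≤-Reasoning

mod-double : ∀ r y j → r < 2 → (r + 2 * y) %2^ suc j ≡ r + 2 * (y %2^ j)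
mod-double r y j r<2 = begin
  (r + 2 * y) % (2 * M)                 ≡⟨ %-congˡ (cong (λ w → r + 2 * w) (m≡m%n+[m/n]*n y M)) ⟩
  (r + 2 * (a + q * M)) % (2 * M)       ≡⟨ %-congˡ (regroup r a q M) ⟩
  ((r + 2 * a) + q * (2 * M)) % (2 * M) ≡⟨ [m+kn]%n≡m%n (r + 2 * a) q (2 * M) ⟩
  (r + 2 * a) % (2 * M)                 ≡⟨ m<n⇒m%n≡m (digit+double< r<2 (m%n<n y M)) ⟩
  r + 2 * a                             ∎
  where
  open ≡-Reasoning
  M : ℕ
  M = 2 ^ j
  instance
    M≢0 : NonZero M
    M≢0 = m^n≢0 2 j
    2M≢0 : NonZero (2 * M)
    2M≢0 = m^n≢0 2 (suc j)
  a q : ℕ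
  a = y % M
  q = y / M
  regroup : ∀ r a q M → r + 2 * (a + q * M) ≡ (r + 2 * a) + q * (2 * M)
  regroup = solve-∀

-- The layers of ℤ_{2^n}, as defined by congruences in Defs, are exactly the
-- fibres of layerOf.  The three lemmas below are the inductive steps.
layer-zero : ∀ i → Layer 0 i 0 ⇔ i ≡ 1
layer-zero i = mk⇔ to λ { refl → inj₂ (refl , refl) }
  where
  to : Layer 0 i 0 → i ≡ 1
  to (inj₁ (1≤i , i≤0 , _)) = ⊥-elim (<-irrefl refl (≤-trans 1≤i i≤0))
  to (inj₂ (i≡1 , _)) = i≡1

layer-even : ∀ n i z → Layer (suc n) (suc i) (2 * z) ⇔ Layer n i z
layer-even n i z = mk⇔ (to i) (from i)
  where
  to : ∀ i → Layer (suc n) (suc i) (2 * z) → Layer n i z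
  to zero (inj₁ (_ , _ , eq)) = ⊥-elim (0≢1+n (trans (sym even-mod-2) eq))
    where
    even-mod-2 : (2 * z) %2^ 1 ≡ 0
    even-mod-2 = trans (mod-double 0 z 0 (s≤s z≤n)) (cong (2 *_) (n%1≡0 z))
  to (suc j) (inj₁ (_ , s≤s i≤n , eq)) =
    inj₁ (s≤s z≤n , i≤n , *-cancelˡ-≡ _ _ 2 (trans (sym (mod-double 0 z (suc j) (s≤s z≤n))) eq))
  to i (inj₂ (refl , 2z≡0)) = inj₂ (refl , *-cancelˡ-≡ z 0 2 2z≡0)
  from : ∀ i → Layer n i z → Layer (suc n) (suc i) (2 * z)
  from zero (inj₁ (() , _))
  from (suc j) (inj₁ (_ , i≤n , eq)) =
    inj₁ (s≤s z≤n , s≤s i≤n , trans (mod-double 0 z (suc j) (s≤s z≤n)) (cong (2 *_) eq))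
  from i (inj₂ (refl , refl)) = inj₂ (refl , refl)

layer-odd : ∀ n i z → Layer (suc n) i (1 + 2 * z) ⇔ i ≡ 1
layer-odd n i z = mk⇔ (to i) λ { refl → inj₁ (s≤s z≤n , s≤s z≤n , first-layer) }
  where
  to : ∀ i → Layer (suc n) i (1 + 2 * z) → i ≡ 1
  to zero (inj₁ (() , _))
  to (suc zero) (inj₁ _) = refl
  to (suc (suc j)) (inj₁ (_ , _ , eq)) =
    ⊥-elim (odd≢even (z %2^ suc j) (2 ^ j) (trans (sym (mod-double 1 z (suc j) (s≤s (s≤s z≤n)))) eq))
  to i (inj₂ (_ , ()))
  first-layer : (1 + 2 * z) %2^ 1 ≡ 1
  first-layer = trans (mod-double 1 z 0 (s≤s (s≤s z≤n))) (cong (λ w → 1 + 2 * w) (n%1≡0 z))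

layer-index : ∀ n i y → y < 2 ^ n → Layer n i y ⇔ i ≡ layerOf n y
layer-index zero i zero _ = layer-zero i
layer-index zero i (suc y) (s≤s ())
layer-index (suc n) i y y<2^n with parityView y
... | odd z rewrite layerOf-odd n z = layer-odd n i z
... | even z rewrite layerOf-even n z with i
...   | zero = mk⇔ (λ { (inj₁ (() , _)) ; (inj₂ (() , _)) }) λ ()
...   | suc j = ⇔-trans (layer-even n j z)
                  (⇔-trans (layer-index n j z (*-cancelˡ-< 2 z (2 ^ n) y<2^n)) (mk⇔ (cong suc) suc-injective))

memL : List ℕ → ℕ → Bool
memL J x = any (_≡ᵇ x) J

any-cong : ∀ (p q : ℕ → Bool) J → (∀ i → p i ≡ q i) → any p J ≡ any q J
any-cong p q [] _ = refl
any-cong p q (i ∷ J) p≗q = cong₂ _∨_ (p≗q i) (any-cong p q J p≗q)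

unionLayers-layerOf : ∀ n J y → y < 2 ^ n →
  any (λ i → isYes (layer? n i y)) J ≡ memL J (layerOf n y)
unionLayers-layerOf n J y y<2^n = any-cong _ _ J λ i →
  trans (isYes≗does (layer? n i y)) (does-⇔ (layer-index n i y y<2^n) (layer? n i y) (i ≟ layerOf n y))

-- Counting residues by layer.  For a layer predicate P, countLayers n P is
-- the number of x ∈ ℤ_{2^n} whose layer satisfies P; layer i has 2^{n-i}
-- elements for i ≤ n and layer n + 1 has one.
indicator : Bool → ℕ
indicator true  = 1
indicator false = 0

countLayers : ℕ → (ℕ → Bool) → ℕ
countLayers zero    P = indicator (P 1)
countLayers (suc n) P = 2 ^ n * indicator (P 1) + countLayers n (λ i → P (suc i))

sumBelow : ℕ → (ℕ → ℕ) → ℕ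
sumBelow zero    g = 0
sumBelow (suc N) g = g 0 + sumBelow N (λ x → g (suc x))

sumBelow-cong : ∀ N g h → (∀ x → x < N → g x ≡ h x) → sumBelow N g ≡ sumBelow N h
sumBelow-cong zero    g h _   = refl
sumBelow-cong (suc N) g h g≗h = cong₂ _+_ (g≗h 0 (s≤s z≤n)) (sumBelow-cong N _ _ λ x x<N → g≗h (suc x) (s≤s x<N))

sumBelow-const : ∀ N c → sumBelow N (λ _ → c) ≡ N * c
sumBelow-const zero    c = refl
sumBelow-const (suc N) c = cong (c +_) (sumBelow-const N c)

sumBelow-halves : ∀ N g → sumBelow (N + N) g ≡ sumBelow N (λ x → g (2 * x)) + sumBelow N (λ x → g (1 + 2 * x))
sumBelow-halves zero g = refl
sumBelow-halves (suc N) g rewrite +-suc N N = begin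
  g 0 + (g 1 + sumBelow (N + N) (λ x → g (2 + x)))
    ≡⟨ cong (λ w → g 0 + (g 1 + w)) (sumBelow-halves N (λ x → g (2 + x))) ⟩
  g 0 + (g 1 + (Evens + Odds))
    ≡⟨ interchange (g 0) (g 1) Evens Odds ⟩
  (g 0 + Evens) + (g 1 + Odds)
    ≡⟨ cong₂ (λ u v → (g 0 + u) + (g 1 + v))
         (sumBelow-cong N _ _ λ x _ → cong g (sym (*-suc 2 x)))
         (sumBelow-cong N _ _ λ x _ → cong (λ w → g (suc w)) (sym (*-suc 2 x))) ⟩
  sumBelow (suc N) (λ x → g (2 * x)) + sumBelow (suc N) (λ x → g (1 + 2 * x))
    ∎
  where
  open ≡-Reasoning
  Evens Odds : ℕ
  Evens = sumBelow N (λ x → g (2 + 2 * x))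
  Odds  = sumBelow N (λ x → g (3 + 2 * x))
  interchange : ∀ a b X Y → a + (b + (X + Y)) ≡ (a + X) + (b + Y)
  interchange = solve-∀

-- countLayers really counts: even residues are doubles of ℤ_{2^n} shifted one
-- layer up, odd residues all lie in layer 1.
countLayers-sum : ∀ n P → sumBelow (2 ^ n) (λ x → indicator (P (layerOf n x))) ≡ countLayers n P
countLayers-sum zero P = +-identityʳ _
countLayers-sum (suc n) P = begin
  sumBelow (2 ^ n + (2 ^ n + 0)) g
    ≡⟨ cong (λ N → sumBelow (2 ^ n + N) g) (+-identityʳ (2 ^ n)) ⟩
  sumBelow (2 ^ n + 2 ^ n) g
    ≡⟨ sumBelow-halves (2 ^ n) g ⟩
  sumBelow (2 ^ n) (λ x → g (2 * x)) + sumBelow (2 ^ n) (λ x → g (1 + 2 * x))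
    ≡⟨ cong₂ _+_ (sumBelow-cong (2 ^ n) _ _ λ x _ → cong (λ l → indicator (P l)) (layerOf-even n x))
                 (sumBelow-cong (2 ^ n) _ _ λ x _ → cong (λ l → indicator (P l)) (layerOf-odd n x)) ⟩
  sumBelow (2 ^ n) (λ x → indicator (P (suc (layerOf n x)))) + sumBelow (2 ^ n) (λ _ → indicator (P 1))
    ≡⟨ cong₂ _+_ (countLayers-sum n (λ i → P (suc i))) (sumBelow-const (2 ^ n) (indicator (P 1))) ⟩
  countLayers n (λ i → P (suc i)) + 2 ^ n * indicator (P 1)
    ≡⟨ +-comm (countLayers n (λ i → P (suc i))) _ ⟩
  countLayers (suc n) P
    ∎
  where
  open ≡-Reasoning
  g : ℕ → ℕ
  g x = indicator (P (layerOf (suc n) x))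

∣tabulate∣ : ∀ N (h : ℕ → Bool) → ∣ tabulate {n = N} (λ x → h (toℕ x)) ∣ ≡ sumBelow N (λ x → indicator (h x))
∣tabulate∣ zero    h = refl
∣tabulate∣ (suc N) h with h 0
... | true  = cong suc (∣tabulate∣ N (λ x → h (suc x)))
... | false = ∣tabulate∣ N (λ x → h (suc x))

count-unionLayers : ∀ n J → ∣ unionLayers n J ∣ ≡ countLayers n (memL J)
count-unionLayers n J = begin
  ∣ unionLayers n J ∣
    ≡⟨ ∣tabulate∣ (2 ^ n) (λ y → any (λ i → isYes (layer? n i y)) J) ⟩
  sumBelow (2 ^ n) (λ y → indicator (any (λ i → isYes (layer? n i y)) J))
    ≡⟨ sumBelow-cong (2 ^ n) _ _ (λ y y<2^n → cong indicator (unionLayers-layerOf n J y y<2^n)) ⟩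
  sumBelow (2 ^ n) (λ y → indicator (memL J (layerOf n y)))
    ≡⟨ countLayers-sum n (memL J) ⟩
  countLayers n (memL J)
    ∎
  where open ≡-Reasoning

indicator-mono : ∀ a b → (a ≡ true → b ≡ true) → indicator a ≤ indicator b
indicator-mono false b _   = z≤n
indicator-mono true  b a⇒b rewrite a⇒b refl = ≤-refl

indicator≤1 : ∀ a → indicator a ≤ 1
indicator≤1 true  = ≤-refl
indicator≤1 false = z≤n

countLayers-mono : ∀ n P Q → (∀ i → 1 ≤ i → i ≤ suc n → P i ≡ true → Q i ≡ true) →
  countLayers n P ≤ countLayers n Q
countLayers-mono zero    P Q P⊆Q = indicator-mono _ _ (P⊆Q 1 ≤-refl ≤-refl)
countLayers-mono (suc n) P Q P⊆Q =
  +-mono-≤ (*-monoʳ-≤ (2 ^ n) (indicator-mono _ _ (P⊆Q 1 ≤-refl (s≤s z≤n))))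
           (countLayers-mono n _ _ λ i _ i≤n → P⊆Q (suc i) (s≤s z≤n) (s≤s i≤n))

countLayers-cong : ∀ n P Q → (∀ i → P i ≡ Q i) → countLayers n P ≡ countLayers n Q
countLayers-cong zero    P Q P≗Q = cong indicator (P≗Q 1)
countLayers-cong (suc n) P Q P≗Q =
  cong₂ (λ b c → 2 ^ n * indicator b + c) (P≗Q 1) (countLayers-cong n _ _ λ i → P≗Q (suc i))

countLayers-max : ∀ n P → countLayers n P ≤ 2 ^ n
countLayers-max zero    P = indicator≤1 (P 1)
countLayers-max (suc n) P = begin
  2 ^ n * indicator (P 1) + countLayers n (λ i → P (suc i))
    ≤⟨ +-mono-≤ (*-monoʳ-≤ (2 ^ n) (indicator≤1 (P 1))) (countLayers-max n _) ⟩
  2 ^ n * 1 + 2 ^ n                                         ≡⟨ cong (_+ 2 ^ n) (*-identityʳ (2 ^ n)) ⟩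
  2 ^ n + 2 ^ n                                             ≡⟨ cong (2 ^ n +_) (+-identityʳ (2 ^ n)) ⟨
  2 ^ suc n                                                 ∎
  where open ≤-Reasoning

-- Missing a layer m ≥ 1 costs at least as much as all layers above m are worth:
-- a layer predicate avoiding m counts at most as much as one containing 1, …, m.
countLayers-missing : ∀ n m P Q → 1 ≤ m → P m ≡ false → (∀ i → 1 ≤ i → i ≤ m → Q i ≡ true) →
  countLayers n P ≤ countLayers n Q
countLayers-missing zero (suc zero) P Q _ P1 _ rewrite P1 = z≤n
countLayers-missing zero (suc (suc m)) P Q _ _ Q↑ rewrite Q↑ 1 ≤-refl (s≤s z≤n) = indicator≤1 (P 1)
countLayers-missing (suc n) (suc zero) P Q _ P1 Q↑ rewrite P1 | Q↑ 1 ≤-refl ≤-refl = begin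
  2 ^ n * 0 + countLayers n (λ i → P (suc i)) ≡⟨ cong (_+ countLayers n (λ i → P (suc i))) (*-zeroʳ (2 ^ n)) ⟩
  countLayers n (λ i → P (suc i))             ≤⟨ countLayers-max n _ ⟩
  2 ^ n                                       ≡⟨ *-identityʳ (2 ^ n) ⟨
  2 ^ n * 1                                   ≤⟨ m≤m+n (2 ^ n * 1) _ ⟩
  2 ^ n * 1 + countLayers n (λ i → Q (suc i)) ∎
  where open ≤-Reasoning
countLayers-missing (suc n) (suc (suc m)) P Q _ Pm Q↑ =
  +-mono-≤ (*-monoʳ-≤ (2 ^ n) (indicator-mono _ _ λ _ → Q↑ 1 ≤-refl (s≤s z≤n)))
           (countLayers-missing n (suc m) _ _ (s≤s z≤n) Pm λ i 1≤i i≤m → Q↑ (suc i) (s≤s z≤n) (s≤s i≤m))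

countLayers-drop : ∀ a n P Q → (∀ i → 1 ≤ i → i ≤ a → P i ≡ Q i) →
  countLayers (a + n) P < countLayers (a + n) Q →
  countLayers n (λ i → P (a + i)) < countLayers n (λ i → Q (a + i))
countLayers-drop zero n P Q _ lt = lt
countLayers-drop (suc a) n P Q agree lt =
  countLayers-drop a n (λ i → P (suc i)) (λ i → Q (suc i)) (λ i _ i≤a → agree (suc i) (s≤s z≤n) (s≤s i≤a))
    (+-cancelˡ-< (2 ^ (a + n) * indicator (Q 1)) _ _
       (subst (λ b → 2 ^ (a + n) * indicator b + countLayers (a + n) (λ i → P (suc i)) < _)
              (agree 1 ≤-refl (s≤s z≤n)) lt))

countLayers-witness : ∀ n P → 0 < countLayers n P → Σ ℕ λ x → P (layerOf n x) ≡ true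
countLayers-witness zero P pos with P 1
... | true = 0 , refl
countLayers-witness zero P () | false
countLayers-witness (suc n) P pos with P 1 in P1
... | true = 1 , P1
... | false with countLayers-witness n (λ i → P (suc i))
                   (subst (0 <_) (cong (_+ countLayers n (λ i → P (suc i))) (*-zeroʳ (2 ^ n))) pos)
...   | x , Px = 2 * x , trans (cong P (layerOf-even n x)) Px

memL⇔∈ : ∀ J x → memL J x ≡ true ⇔ x ∈L J
memL⇔∈ J x = ⇔-trans (⇔-sym T-≡) (⇔-trans (⇔-sym any⇔)
  (mk⇔ (Any.map λ {i} t → sym (≡ᵇ⇒≡ i x t)) (Any.map λ {i} i≡x → ≡⇒≡ᵇ i x (sym i≡x))))

memL-∉ : ∀ {x} J → x ∉L J → memL J x ≡ false
memL-∉ {x} J x∉J = ¬-not λ x∈J → x∉J (Equivalence.to (memL⇔∈ J x) x∈J)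

residual : ℕ → ℕ
residual d = d ∸ 2 ^ ⌊log₂ d ⌋ + 1

shift-index : ∀ j ℓ → j + ℓ + 1 ≡ suc ℓ + j
shift-index = solve-∀

index-pos : ∀ f d → 0 ∉L indexAux f d
index-pos zero          d             ()
index-pos (suc f)       zero          ()
index-pos (suc f)       (suc zero)    ()
index-pos (suc f)       (suc (suc k)) 0∈I with ∈-++⁻ (map suc (upTo ⌊log₂ suc (suc k) ⌋)) 0∈I
... | inj₁ 0∈low with ∈-map⁻ suc 0∈low
...   | _ , _ , ()
index-pos (suc f) (suc (suc k)) 0∈I | inj₂ 0∈high with ∈-map⁻ (λ j → j + ⌊log₂ suc (suc k) ⌋ + 1) 0∈high
...   | j , _ , 0≡j+ℓ+1 with trans 0≡j+ℓ+1 (shift-index j _)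
...     | ()

index-low : ∀ f k i → 1 ≤ i → i ≤ ⌊log₂ suc (suc k) ⌋ → i ∈L indexAux (suc f) (suc (suc k))
index-low f k (suc i) _ i<ℓ = ∈-++⁺ˡ (∈-map⁺ suc (∈-upTo⁺ i<ℓ))

index-high : ∀ f k j → let d = suc (suc k) in
  suc ⌊log₂ d ⌋ + j ∈L indexAux (suc f) d ⇔ j ∈L indexAux f (residual d)
index-high f k j = mk⇔ to from
  where
  ℓ : ℕ
  ℓ = ⌊log₂ suc (suc k) ⌋
  to : suc ℓ + j ∈L indexAux (suc f) (suc (suc k)) → j ∈L indexAux f (residual (suc (suc k)))
  to ∈I with ∈-++⁻ (map suc (upTo ℓ)) ∈I
  ... | inj₁ ∈low with ∈-map⁻ suc ∈low
  ...   | i , i∈upTo , eq = ⊥-elim (<⇒≱ (∈-upTo⁻ i∈upTo) (≤-trans (m≤m+n ℓ j) (≤-reflexive (suc-injective eq))))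
  to ∈I | inj₂ ∈high with ∈-map⁻ (λ j → j + ℓ + 1) ∈high
  ...   | y , y∈I , eq = subst (_∈L _) (sym (+-cancelˡ-≡ (suc ℓ) j y (trans eq (shift-index y ℓ)))) y∈I
  from : j ∈L indexAux f (residual (suc (suc k))) → suc ℓ + j ∈L indexAux (suc f) (suc (suc k))
  from j∈I = ∈-++⁺ʳ (map suc (upTo ℓ))
    (subst (_∈L map (λ j → j + ℓ + 1) (indexAux f (residual (suc (suc k))))) (shift-index j ℓ)
           (∈-map⁺ (λ j → j + ℓ + 1) j∈I))

double-half≤ : ∀ m → 2 * ⌊ m /2⌋ ≤ m
double-half≤ zero          = z≤n
double-half≤ (suc zero)    = z≤n
double-half≤ (suc (suc m)) rewrite *-suc 2 ⌊ m /2⌋ = s≤s (s≤s (double-half≤ m))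

≤1+double-half : ∀ m → m ≤ 1 + 2 * ⌊ m /2⌋
≤1+double-half zero          = z≤n
≤1+double-half (suc zero)    = ≤-refl
≤1+double-half (suc (suc m)) rewrite *-suc 2 ⌊ m /2⌋ = s≤s (s≤s (≤1+double-half m))

log2-bounds : ∀ n (ac : Acc _<_ n) → 1 ≤ n → 2 ^ ⌊log2⌋ n ac ≤ n × n < 2 ^ suc (⌊log2⌋ n ac)
log2-bounds (suc zero) _ _ = ≤-refl , s≤s (s≤s z≤n)
log2-bounds (suc (suc m)) (acc rs) _ with log2-bounds (suc ⌊ m /2⌋) (rs (⌊n/2⌋<n (suc m))) (s≤s z≤n)
... | lower , upper = lower′ , upper′
  where
  open ≤-Reasoning
  h L : ℕ
  h = ⌊ m /2⌋
  L = ⌊log2⌋ (suc h) (rs (⌊n/2⌋<n (suc m)))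
  lower′ : 2 * 2 ^ L ≤ suc (suc m)
  lower′ = begin
    2 * 2 ^ L   ≤⟨ *-monoʳ-≤ 2 lower ⟩
    2 * suc h   ≡⟨ *-suc 2 h ⟩
    2 + 2 * h   ≤⟨ +-monoʳ-≤ 2 (double-half≤ m) ⟩
    2 + m       ∎
  upper′ : suc (suc m) < 2 * 2 ^ suc L
  upper′ = begin-strict
    2 + m             ≤⟨ +-monoʳ-≤ 2 (≤1+double-half m) ⟩
    3 + 2 * h         <⟨ ≤-refl ⟩
    4 + 2 * h         ≡⟨ cong (2 +_) (*-suc 2 h) ⟨
    2 + 2 * suc h     ≡⟨ *-suc 2 (suc h) ⟨
    2 * suc (suc h)   ≤⟨ *-monoʳ-≤ 2 upper ⟩
    2 * 2 ^ suc L     ∎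

log₂-facts : ∀ k → let ℓ = ⌊log₂ suc (suc k) ⌋ in 1 ≤ ℓ × 2 ^ ℓ ≤ suc (suc k) × suc (suc k) < 2 ^ suc ℓ
log₂-facts k with log2-bounds (suc (suc k)) (<-wellFounded (suc (suc k))) (s≤s z≤n)
... | lower , upper = ℓ-pos _ upper , lower , upper
  where
  ℓ-pos : ∀ ℓ → suc (suc k) < 2 ^ suc ℓ → 1 ≤ ℓ
  ℓ-pos (suc ℓ) _ = s≤s z≤n
  ℓ-pos zero (s≤s (s≤s ()))

maskedSum : ∀ {d} → Vec ℕ d → Subset d → ℕ
maskedSum []      []           = 0
maskedSum (a ∷ T) (true  ∷ Q) = a + maskedSum T Q
maskedSum (a ∷ T) (false ∷ Q) = maskedSum T Q

maskedSum-++ : ∀ {d e} (T₁ : Vec ℕ d) (T₂ : Vec ℕ e) Q₁ Q₂ →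
  maskedSum (T₁ ++ᵛ T₂) (Q₁ ++ᵛ Q₂) ≡ maskedSum T₁ Q₁ + maskedSum T₂ Q₂
maskedSum-++ []      T₂ []           Q₂ = refl
maskedSum-++ (a ∷ T₁) T₂ (true  ∷ Q₁) Q₂ =
  trans (cong (a +_) (maskedSum-++ T₁ T₂ Q₁ Q₂)) (sym (+-assoc a _ _))
maskedSum-++ (a ∷ T₁) T₂ (false ∷ Q₁) Q₂ = maskedSum-++ T₁ T₂ Q₁ Q₂

maskedSum-scale : ∀ {d} c (T : Vec ℕ d) Q → maskedSum (mapᵛ (c *_) T) Q ≡ c * maskedSum T Q
maskedSum-scale c []      []           = sym (*-zeroʳ c)
maskedSum-scale c (a ∷ T) (true  ∷ Q) =
  trans (cong (c * a +_) (maskedSum-scale c T Q)) (sym (*-distribˡ-+ c a _))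
maskedSum-scale c (a ∷ T) (false ∷ Q) = maskedSum-scale c T Q

maskedSum-⊥ : ∀ {d} (T : Vec ℕ d) → maskedSum T ⊥ ≡ 0
maskedSum-⊥ []      = refl
maskedSum-⊥ (a ∷ T) = maskedSum-⊥ T

ones-sum-pos : ∀ r (Q : Subset r) → Nonempty Q → 1 ≤ maskedSum (replicateᵛ r 1) Q
ones-sum-pos (suc r) (true  ∷ Q) _               = s≤s z≤n
ones-sum-pos (suc r) (false ∷ Q) (suc x , x∈Q) = ones-sum-pos r Q (x , drop-there x∈Q)

ones-sum-≤ : ∀ r (Q : Subset r) → maskedSum (replicateᵛ r 1) Q ≤ r
ones-sum-≤ zero    []           = z≤n
ones-sum-≤ (suc r) (true  ∷ Q) = s≤s (ones-sum-≤ r Q)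
ones-sum-≤ (suc r) (false ∷ Q) = m≤n⇒m≤1+n (ones-sum-≤ r Q)

nonempty-++ʳ : ∀ {d e} (Q₁ : Subset d) (Q₂ : Subset e) → Nonempty (Q₁ ++ᵛ Q₂) → Empty Q₁ → Nonempty Q₂
nonempty-++ʳ []          Q₂ ne _  = ne
nonempty-++ʳ (true ∷ Q₁) Q₂ _  e₁ = ⊥-elim (e₁ (zero , here))
nonempty-++ʳ (false ∷ Q₁) Q₂ (zero , ()) _
nonempty-++ʳ (false ∷ Q₁) Q₂ (suc x , x∈) e₁ = nonempty-++ʳ Q₁ Q₂ (x , drop-there x∈) (drop-∷-Empty e₁)

-- A layer cube of dimension d in ℤ_{2^n} for the layer predicate P: d natural
-- numbers all of whose nonempty subset sums have their layer in P.  Reduced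
-- modulo 2^n it is a projective d-cube inside the union of the layers in P.
record LayerCube (n : ℕ) (P : ℕ → Bool) (d : ℕ) : Set where
  field
    generators : Vec ℕ d
    sums-in-P  : ∀ Q → Nonempty Q → P (layerOf n (maskedSum generators Q)) ≡ true
open LayerCube

emptyCube : ∀ n P → LayerCube n P 0
emptyCube n P = record { generators = [] ; sums-in-P = λ { [] (() , _) } }

singletonCube : ∀ n P x → P (layerOf n x) ≡ true → LayerCube n P 1
singletonCube n P x Px = record { generators = x ∷ [] ; sums-in-P = sums }
  where
  sums : ∀ Q → Nonempty Q → P (layerOf n (maskedSum (x ∷ []) Q)) ≡ true
  sums (true  ∷ []) _ = subst (λ y → P (layerOf n y) ≡ true) (sym (+-identityʳ x)) Px
  sums (false ∷ []) (zero , ())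

-- If P contains the layers 1, …, j, then d < 2^j copies of 1 form a cube:
-- their subset sums lie in [1, d], hence in the layers 1, …, j.
onesCube : ∀ n P d j → d < 2 ^ j → (∀ i → 1 ≤ i → i ≤ j → P i ≡ true) → LayerCube n P d
onesCube n P d j d<2^j P↓ = record { generators = replicateᵛ d 1 ; sums-in-P = sums }
  where
  sums : ∀ Q → Nonempty Q → P (layerOf n (maskedSum (replicateᵛ d 1) Q)) ≡ true
  sums Q ne = P↓ _ (layerOf-pos n s) (subst (λ y → layerOf n y ≤ j) s+0≡s
    (layerOf-bound n j s 0 (ones-sum-pos d Q ne) (≤-<-trans (ones-sum-≤ d Q) d<2^j)))
    where
    s : ℕ
    s = maskedSum (replicateᵛ d 1) Q
    s+0≡s : s + 2 ^ j * 0 ≡ s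
    s+0≡s = trans (cong (s +_) (*-zeroʳ (2 ^ j))) (+-identityʳ s)

-- If P contains the layers 1, …, ℓ, then r < 2^ℓ ones
-- together with 2^{ℓ+1} times a cube for the layers of P above ℓ + 1 form a
-- cube: a subset sum using some of the ones is 2^{ℓ+1}·s plus a number in
-- [1, 2^ℓ), so it lies in a layer ≤ ℓ; otherwise it is 2^{ℓ+1}·s, lying
-- ℓ + 1 layers above s.
extendCube : ∀ n P r ℓ {d} → r < 2 ^ ℓ → (∀ i → 1 ≤ i → i ≤ ℓ → P i ≡ true) →
  LayerCube n (λ i → P (suc ℓ + i)) d → LayerCube (suc ℓ + n) P (r + d)
extendCube n P r ℓ {d} r<2^ℓ P↓ cube = record { generators = T ; sums-in-P = sums }
  where
  T′ : Vec ℕ d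
  T′ = generators cube
  T : Vec ℕ (r + d)
  T  = replicateᵛ r 1 ++ᵛ mapᵛ (2 ^ suc ℓ *_) T′
  sum-split : ∀ Q₁ Q₂ → maskedSum T (Q₁ ++ᵛ Q₂) ≡ maskedSum (replicateᵛ r 1) Q₁ + 2 ^ suc ℓ * maskedSum T′ Q₂
  sum-split Q₁ Q₂ = trans (maskedSum-++ (replicateᵛ r 1) _ Q₁ Q₂)
                          (cong (maskedSum (replicateᵛ r 1) Q₁ +_) (maskedSum-scale (2 ^ suc ℓ) T′ Q₂))
  sums : ∀ Q → Nonempty Q → P (layerOf (suc ℓ + n) (maskedSum T Q)) ≡ true
  sums Q ne with splitAt r Q
  ... | Q₁ , Q₂ , refl with nonempty? Q₁
  ...   | yes ne₁ = P↓ _ (layerOf-pos (suc ℓ + n) _) (subst (λ y → layerOf (suc ℓ + n) y ≤ ℓ) eq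
            (layerOf-bound (suc ℓ + n) ℓ k (2 * s) (ones-sum-pos r Q₁ ne₁) (≤-<-trans (ones-sum-≤ r Q₁) r<2^ℓ)))
    where
    k s : ℕ
    k = maskedSum (replicateᵛ r 1) Q₁
    s = maskedSum T′ Q₂
    eq : k + 2 ^ ℓ * (2 * s) ≡ maskedSum T (Q₁ ++ᵛ Q₂)
    eq = begin
      k + 2 ^ ℓ * (2 * s) ≡⟨ cong (k +_) (*-assoc (2 ^ ℓ) 2 s) ⟨
      k + 2 ^ ℓ * 2 * s   ≡⟨ cong (λ c → k + c * s) (*-comm (2 ^ ℓ) 2) ⟩
      k + 2 ^ suc ℓ * s   ≡⟨ sum-split Q₁ Q₂ ⟨
      maskedSum T (Q₁ ++ᵛ Q₂) ∎
      where open ≡-Reasoning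
  ...   | no ¬ne₁ with refl ← Empty-unique ¬ne₁ = subst (λ l → P l ≡ true) (sym eq)
            (sums-in-P cube Q₂ (nonempty-++ʳ ⊥ Q₂ ne ¬ne₁))
    where
    s : ℕ
    s = maskedSum T′ Q₂
    eq : layerOf (suc ℓ + n) (maskedSum T (⊥ ++ᵛ Q₂)) ≡ suc ℓ + layerOf n s
    eq = begin
      layerOf (suc ℓ + n) (maskedSum T (⊥ ++ᵛ Q₂))
        ≡⟨ cong (layerOf (suc ℓ + n)) (sum-split ⊥ Q₂) ⟩
      layerOf (suc ℓ + n) (maskedSum (replicateᵛ r 1) ⊥ + 2 ^ suc ℓ * s)
        ≡⟨ cong (λ k → layerOf (suc ℓ + n) (k + 2 ^ suc ℓ * s)) (maskedSum-⊥ (replicateᵛ r 1)) ⟩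
      layerOf (suc ℓ + n) (2 ^ suc ℓ * s)
        ≡⟨ layerOf-shift (suc ℓ) n s ⟩
      suc ℓ + layerOf n s
        ∎
      where open ≡-Reasoning

upto-suc : ∀ (P : ℕ → Bool) ℓ → (∀ i → 1 ≤ i → i ≤ ℓ → P i ≡ true) → P (suc ℓ) ≡ true →
  ∀ i → 1 ≤ i → i ≤ suc ℓ → P i ≡ true
upto-suc P ℓ P↓ Pℓ+1 i 1≤i i≤ℓ+1 with m≤n⇒m<n∨m≡n i≤ℓ+1
... | inj₁ (s≤s i≤ℓ) = P↓ i 1≤i i≤ℓ
... | inj₂ refl      = Pℓ+1

layers-upto? : ∀ (P : ℕ → Bool) ℓ →
  (∀ i → 1 ≤ i → i ≤ ℓ → P i ≡ true) ⊎ Σ ℕ λ m → 1 ≤ m × m ≤ ℓ × P m ≡ false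
layers-upto? P zero = inj₁ λ i 1≤i i≤0 → ⊥-elim (<-irrefl refl (≤-trans 1≤i i≤0))
layers-upto? P (suc ℓ) with layers-upto? P ℓ | P (suc ℓ) in Pℓ+1
... | inj₂ (m , 1≤m , m≤ℓ , Pm) | _     = inj₂ (m , 1≤m , m≤n⇒m≤1+n m≤ℓ , Pm)
... | inj₁ P↓                   | false = inj₂ (suc ℓ , s≤s z≤n , ≤-refl , Pℓ+1)
... | inj₁ P↓                   | true  = inj₁ (upto-suc P ℓ P↓ Pℓ+1)

distinct-layers : ∀ (P : ℕ → Bool) {i j} → P i ≡ true → P j ≡ false → i ≢ j
distinct-layers P Pi Pj refl with trans (sym Pi) Pj
... | ()

module RecursionStep (f k : ℕ) where
  d : ℕ
  d = suc (suc k)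

  ℓ : ℕ
  ℓ = ⌊log₂ d ⌋

  1≤ℓ : 1 ≤ ℓ
  1≤ℓ = proj₁ (log₂-facts k)

  2^ℓ≤d : 2 ^ ℓ ≤ d
  2^ℓ≤d = proj₁ (proj₂ (log₂-facts k))

  d<2^[1+ℓ] : d < 2 ^ suc ℓ
  d<2^[1+ℓ] = proj₂ (proj₂ (log₂-facts k))

  1≤2^ℓ : 1 ≤ 2 ^ ℓ
  1≤2^ℓ = ^-monoʳ-≤ 2 (z≤n {ℓ})

  inI inI′ : ℕ → Bool
  inI  = memL (indexAux (suc f) d)
  inI′ = memL (indexAux f (residual d))

  inI-low : ∀ i → 1 ≤ i → i ≤ ℓ → inI i ≡ true
  inI-low i 1≤i i≤ℓ = Equivalence.from (memL⇔∈ _ i) (index-low f k i 1≤i i≤ℓ)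

  inI-high : ∀ j → inI (suc ℓ + j) ≡ inI′ j
  inI-high j = ⇔→≡ (⇔-trans (memL⇔∈ _ _) (⇔-trans (index-high f k j) (⇔-sym (memL⇔∈ _ _))))

  inI-gap : inI (suc ℓ) ≡ false
  inI-gap = trans (cong inI (sym (+-identityʳ (suc ℓ)))) (trans (inI-high 0) (memL-∉ _ (index-pos f (residual d))))

  -- The recursion decreases d, so fuel f suffices for residual d.
  residual≤ : residual d ≤ suc k
  residual≤ = begin
    d ∸ 2 ^ ℓ + 1 ≤⟨ +-monoˡ-≤ 1 (∸-monoʳ-≤ d (^-monoʳ-≤ 2 1≤ℓ)) ⟩
    k + 1         ≡⟨ +-comm k 1 ⟩
    suc k         ∎
    where open ≤-Reasoning

  split-dimension : (2 ^ ℓ ∸ 1) + residual d ≡ d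
  split-dimension = split (2 ^ ℓ) 1≤2^ℓ 2^ℓ≤d
    where
    split : ∀ p → 1 ≤ p → p ≤ d → (p ∸ 1) + (d ∸ p + 1) ≡ d
    split (suc p) _ p<d = trans (regroup p (d ∸ suc p)) (m∸n+n≡m p<d)
      where
      regroup : ∀ p x → p + (x + 1) ≡ x + suc p
      regroup = solve-∀

  -- The recursive case, for n = ℓ + 1 + n′ and P containing 1, …, ℓ but not
  -- ℓ + 1: the counts of I_d and P agree on the layers 1, …, ℓ + 1, so the
  -- layers above ℓ + 1 of P still beat I_{residual d}; combine the resulting
  -- cube with 2^ℓ - 1 ones.
  step : ∀ n′ P → (∀ i → 1 ≤ i → i ≤ ℓ → P i ≡ true) → P (suc ℓ) ≡ false →
    (∀ n Q → countLayers n inI′ < countLayers n Q → LayerCube n Q (residual d)) →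
    countLayers (suc ℓ + n′) inI < countLayers (suc ℓ + n′) P → LayerCube (suc ℓ + n′) P d
  step n′ P P↓ P-gap cube′ I<P = subst (LayerCube (suc ℓ + n′) P) split-dimension
    (extendCube n′ P (2 ^ ℓ ∸ 1) ℓ (pred< 1≤2^ℓ) P↓ (cube′ n′ (λ i → P (suc ℓ + i)) above))
    where
    pred< : ∀ {p} → 1 ≤ p → p ∸ 1 < p
    pred< {suc p} _ = ≤-refl
    agree : ∀ i → 1 ≤ i → i ≤ suc ℓ → inI i ≡ P i
    agree i 1≤i i≤ℓ+1 with m≤n⇒m<n∨m≡n i≤ℓ+1
    ... | inj₁ (s≤s i≤ℓ) = trans (inI-low i 1≤i i≤ℓ) (sym (P↓ i 1≤i i≤ℓ))
    ... | inj₂ refl      = trans inI-gap (sym P-gap)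
    above : countLayers n′ inI′ < countLayers n′ (λ i → P (suc ℓ + i))
    above = subst (_< countLayers n′ (λ i → P (suc ℓ + i))) (countLayers-cong n′ _ _ inI-high)
                  (countLayers-drop (suc ℓ) n′ inI P agree I<P)

  -- If P misses one of the layers 1, …, ℓ it counts no more than
  -- I_d; if it contains 1, …, ℓ + 1, ones suffice; if it misses ℓ + 1 and
  -- n ≤ ℓ it is contained in I_d; otherwise recurse above layer ℓ + 1.
  cube : ∀ n P → (∀ n Q → countLayers n inI′ < countLayers n Q → LayerCube n Q (residual d)) →
    countLayers n inI < countLayers n P → LayerCube n P d
  cube n P cube′ I<P with layers-upto? P ℓ
  ... | inj₂ (m , 1≤m , m≤ℓ , Pm) =
    ⊥-elim (<⇒≱ I<P (countLayers-missing n m P inI 1≤m Pm λ i 1≤i i≤m → inI-low i 1≤i (≤-trans i≤m m≤ℓ)))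
  ... | inj₁ P↓ with P (suc ℓ) in P-gap
  ...   | true = onesCube n P d (suc ℓ) d<2^[1+ℓ] (upto-suc P ℓ P↓ P-gap)
  ...   | false with n ≤? ℓ
  ...     | yes n≤ℓ = ⊥-elim (<⇒≱ I<P (countLayers-mono n P inI λ i 1≤i i≤n+1 Pi →
              inI-low i 1≤i (≤-pred (≤∧≢⇒< (≤-trans i≤n+1 (s≤s n≤ℓ)) (distinct-layers P Pi P-gap)))))
  ...     | no n≰ℓ with m≤n⇒∃[o]m+o≡n (≰⇒> n≰ℓ)
  ...       | n′ , refl = step n′ P P↓ P-gap cube′ I<P

layerCube : ∀ f d n P → d ≤ f → countLayers n (memL (indexAux f d)) < countLayers n P → LayerCube n P d
layerCube f       zero          n P _ _   = emptyCube n P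
layerCube zero    (suc d)       n P () _
layerCube (suc f) (suc zero)    n P _ I<P with countLayers-witness n P (≤-<-trans z≤n I<P)
... | x , Px = singletonCube n P x Px
layerCube (suc f) (suc (suc k)) n P (s≤s d≤f) =
  RecursionStep.cube f k n P λ n Q → layerCube f _ n Q (≤-trans (RecursionStep.residual≤ f k) d≤f)

module Modulo (n : ℕ) where
  private instance
    2^n≢0 : NonZero (2 ^ n)
    2^n≢0 = m^n≢0 2 n

  toℕ-mod2^ : ∀ x → toℕ (x mod2^ n) ≡ x %2^ n
  toℕ-mod2^ x = toℕ-fromℕ< (m%n<n x (2 ^ n))

  layerOf-mod : ∀ x → layerOf n (x %2^ n) ≡ layerOf n x
  layerOf-mod x = sym (begin
    layerOf n x                                  ≡⟨ cong (layerOf n) (m≡m%n+[m/n]*n x (2 ^ n)) ⟩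
    layerOf n (x % 2 ^ n + x / 2 ^ n * 2 ^ n)    ≡⟨ cong (λ y → layerOf n (x % 2 ^ n + y)) (*-comm (x / 2 ^ n) (2 ^ n)) ⟩
    layerOf n (x % 2 ^ n + 2 ^ n * (x / 2 ^ n))  ≡⟨ layerOf-periodic n (x % 2 ^ n) (x / 2 ^ n) ⟩
    layerOf n (x % 2 ^ n)                        ∎)
    where open ≡-Reasoning

  subsetSum-mod : ∀ {d} (T : Vec ℕ d) Q → subsetSum (mapᵛ (_mod2^ n) T) Q %2^ n ≡ maskedSum T Q %2^ n
  subsetSum-mod []      []           = refl
  subsetSum-mod (a ∷ T) (false ∷ Q) = subsetSum-mod T Q
  subsetSum-mod (a ∷ T) (true  ∷ Q) = begin
    (toℕ (a mod2^ n) + S) % 2 ^ n                  ≡⟨ %-distribˡ-+ (toℕ (a mod2^ n)) S (2 ^ n) ⟩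
    (toℕ (a mod2^ n) % 2 ^ n + S % 2 ^ n) % 2 ^ n  ≡⟨ cong₂ (λ u v → (u + v) % 2 ^ n) a-mod (subsetSum-mod T Q) ⟩
    (a % 2 ^ n + maskedSum T Q % 2 ^ n) % 2 ^ n    ≡⟨ %-distribˡ-+ a (maskedSum T Q) (2 ^ n) ⟨
    (a + maskedSum T Q) % 2 ^ n                    ∎
    where
    open ≡-Reasoning
    S : ℕ
    S = subsetSum (mapᵛ (_mod2^ n) T) Q
    a-mod : toℕ (a mod2^ n) % 2 ^ n ≡ a % 2 ^ n
    a-mod = trans (cong (_% 2 ^ n) (toℕ-mod2^ a)) (m%n%n≡m%n a (2 ^ n))

  ∈-unionLayers : ∀ J (y : Fin (2 ^ n)) → memL J (layerOf n (toℕ y)) ≡ true → y ∈ unionLayers n J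
  ∈-unionLayers J y y∈J = lookup⇒[]= y (unionLayers n J)
    (trans (lookup∘tabulate _ y) (trans (unionLayers-layerOf n J (toℕ y) (toℕ<n y)) y∈J))

  reduce : ∀ {J d} → LayerCube n (memL J) d →
    Σ (Vec (Fin (2 ^ n)) d) λ W → (Q : Subset d) → Nonempty Q → (subsetSum W Q mod2^ n) ∈ unionLayers n J
  reduce {J} {d} cube = W , λ Q ne → ∈-unionLayers J _ (subst (λ l → memL J l ≡ true) (sym (layer-eq Q)) (sums-in-P cube Q ne))
    where
    W : Vec (Fin (2 ^ n)) d
    W = mapᵛ (_mod2^ n) (generators cube)
    layer-eq : ∀ Q → layerOf n (toℕ (subsetSum W Q mod2^ n)) ≡ layerOf n (maskedSum (generators cube) Q)
    layer-eq Q = begin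
      layerOf n (toℕ (subsetSum W Q mod2^ n))         ≡⟨ cong (layerOf n) (toℕ-mod2^ _) ⟩
      layerOf n (subsetSum W Q %2^ n)                 ≡⟨ cong (layerOf n) (subsetSum-mod (generators cube) Q) ⟩
      layerOf n (maskedSum (generators cube) Q %2^ n) ≡⟨ layerOf-mod _ ⟩
      layerOf n (maskedSum (generators cube) Q)       ∎
      where open ≡-Reasoning

claim3p2 : (d n : ℕ) → 1 ≤ d → d ≤ n → (S : Subset (2 ^ n)) →
    (Σ (List ℕ) λ J → All (λ i → 1 ≤ i × i ≤ ℕ.suc n) J × S ≡ unionLayers n J) →
    ∣ C n d ∣ < ∣ S ∣ →
    Σ (Vec (Fin (2 ^ n)) d) λ T →
      (P : Subset d) → Nonempty P → (subsetSum T P mod2^ n) ∈ S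
claim3p2 d n _ _ S (J , _ , refl) 𝒞<S = Modulo.reduce n {J} (layerCube d d n (memL J) ≤-refl counts)
  where
  counts : countLayers n (memL (I d)) < countLayers n (memL J)
  counts = subst₂ _<_ (count-unionLayers n (I d)) (count-unionLayers n J) 𝒞<S
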